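{- Let $G$ be a regular graph and $n\geq 1$. Then the lexicographic product $G\circ\overline{K}_{2n}$ is group distance magic.
   Context: All graphs are finite and simple; $N(x)$ denotes the open neighborhood of $x$. $\overline{K}_m$ is the edgeless graph on $m$ vertices. The lexicographic product $G\circ H$ has vertex set $V(G)\times V(H)$, with $(u,v)$ adjacent to $(x,y)$ iff either $ux\in E(G)$, or $u=x$ and $vy\in E(H)$. For an Abelian group $\Gamma$ of order $|V(G)|$, a $\Gamma$-distance magic labeling of $G$ is a bijection $\ell\colon V(G)\to\Gamma$ such that $\sum_{y\in N(x)}\ell(y)$ is the same element of $\Gamma$ for all $x\in V(G)$. A graph is group distance magic if it admits a $\Gamma$-distance magic labeling for every Abelian group $\Gamma$ of order $|V(G)|$. -}

module Defs where

open import Data.Nat using (ℕ; zero; suc; _+_; _*_)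
open import Data.Bool using (Bool; true; false; if_then_else_; _∧_)
open import Data.Fin using (Fin; remQuot; _≟_)
open import Data.List using (List; foldr; allFin)
open import Data.Product using (_×_; _,_; proj₁; proj₂; Σ; ∃)
open import Relation.Nullary.Decidable using (⌊_⌋)
open import Relation.Binary.PropositionalEquality using (_≡_; refl) renaming (sym to ≡-sym)
open import Relation.Nullary using (yes; no)
open import Data.Empty using (⊥-elim)
open import Algebra.Core using (Op₂; Op₁)
open import Algebra.Structures using (IsAbelianGroup)
open import Function.Definitions using (Bijective)

record Graph : Set where
  field
    order  : ℕ
    Adj    : Fin order → Fin order → Bool
    sym    : ∀ x y → Adj x y ≡ Adj y x
    irrefl : ∀ x → Adj x x ≡ false
open Graph public

degree : (G : Graph) → Fin (order G) → ℕ
degree G x = foldr (λ y acc → if Adj G x y then suc acc else acc) 0 (allFin (order G))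

Regular : Graph → Set
Regular G = ∃ λ k → ∀ x → degree G x ≡ k

edgeless : ℕ → Graph
edgeless m = record { order = m ; Adj = λ _ _ → false
                    ; sym = λ _ _ → refl
                    ; irrefl = λ _ → refl }

-- lexicographic product G ∘ H on vertex set Fin (|G| * |H|), where the vertex
-- with index i corresponds to the pair remQuot |H| i = (u , v) ∈ V(G) × V(H)
-- (a bijection Fin (|G| * |H|) ≅ Fin |G| × Fin |H|, inverse Data.Fin.combine).
-- (u,v) ~ (x,y) iff ux ∈ E(G), or u = x and vy ∈ E(H).
lexAdjPair : (G H : Graph) → Fin (order G) × Fin (order H) → Fin (order G) × Fin (order H) → Bool
lexAdjPair G H (u , v) (x , y) = if Adj G u x then true else (⌊ u ≟ x ⌋ ∧ Adj H v y)

private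
  lexSym : (G H : Graph) → ∀ p q → lexAdjPair G H p q ≡ lexAdjPair G H q p
  lexSym G H (u , v) (x , y) rewrite sym G u x | sym H v y with u ≟ x | x ≟ u
  ... | yes _ | yes _ = refl
  ... | no _  | no _  = refl
  ... | yes e | no ne = ⊥-elim (ne (≡-sym e))
  ... | no ne | yes e = ⊥-elim (ne (≡-sym e))

  lexIrrefl : (G H : Graph) → ∀ p → lexAdjPair G H p p ≡ false
  lexIrrefl G H (u , v) rewrite irrefl G u | irrefl H v with u ≟ u
  ... | yes _ = refl
  ... | no ne = ⊥-elim (ne refl)

_∘ₗ_ : Graph → Graph → Graph
G ∘ₗ H = record
  { order  = order G * order H
  ; Adj    = λ i j → lexAdjPair G H (remQuot (order H) i) (remQuot (order H) j)
  ; sym    = λ i j → lexSym G H (remQuot (order H) i) (remQuot (order H) j)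
  ; irrefl = λ i → lexIrrefl G H (remQuot (order H) i)
  }

nbhdSum : (G : Graph) {A : Set} → Op₂ A → A → (Fin (order G) → A) → Fin (order G) → A
nbhdSum G _∙_ ε ℓ x =
  foldr (λ y acc → if Adj G x y then ℓ y ∙ acc else acc) ε (allFin (order G))

IsDistanceMagicLabeling : (G : Graph) → Op₂ (Fin (order G)) → Fin (order G)
  → (Fin (order G) → Fin (order G)) → Set
IsDistanceMagicLabeling G _∙_ ε ℓ =
  Bijective _≡_ _≡_ ℓ × ∃ λ μ → ∀ x → nbhdSum G _∙_ ε ℓ x ≡ μ

-- group distance magic: for every abelian group of order |V(G)| (every finite
-- abelian group of order |V(G)| is isomorphic to one with carrier Fin |V(G)|)
-- there is a distance magic labeling.
GroupDistanceMagic : Graph → Set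
GroupDistanceMagic G =
  (_∙_ : Op₂ (Fin (order G))) (ε : Fin (order G)) (_⁻¹ : Op₁ (Fin (order G))) →
  IsAbelianGroup _≡_ _∙_ ε _⁻¹ →
  ∃ λ ℓ → IsDistanceMagicLabeling G _∙_ ε ℓ

-- An abelian group Γ of even order 2h has an element c that is not a square: otherwise
-- squaring would be a bijection, so ε would be the only fixed point of the involution
-- a ↦ a⁻¹, and |Γ| = 1 + 2·(number of 2-cycles) would be odd.  Then a ↦ c − a is a
-- fixed-point-free involution, so Γ splits into h pairs {a, c − a}, each summing to c.
-- Label G ∘ K̄₂ₙ (|G| = g, so h = gn) by giving each column {x} × K̄₂ₙ the elements of n
-- of these pairs.  As K̄₂ₙ has no edges, the neighbourhood of (u, v) is the union of the
-- columns of the G-neighbours of u, so its label sum is deg(u)·n·c: constant when G is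
-- regular.
module Submission where

open import Defs hiding (sym)
open import Algebra.Bundles using (AbelianGroup; CommutativeMonoid)
open import Algebra.Core using (Op₁; Op₂)
open import Algebra.Structures using (IsAbelianGroup; IsCommutativeMonoid)
import Algebra.Definitions.RawMonoid as RawMonoidDefinitions
import Algebra.Properties.AbelianGroup as AbelianGroupProperties
import Algebra.Properties.CommutativeMonoid.Sum as CommutativeMonoidSum
import Algebra.Properties.Group as GroupProperties
open import Data.Bool using (Bool; true; false; if_then_else_)
open import Data.Bool.Properties using (∧-zeroʳ)
open import Data.Fin using (Fin; zero; suc; _<_; _<?_; _≟_; _↑ˡ_; _↑ʳ_; combine; remQuot; punchOut; cast)
open import Data.Fin.Patterns using (0F; 1F)
open import Data.Fin.Properties
  using (any?; all?; ¬∀⟶∃¬; injective⇒≤; cantor-schröder-bernstein; punchOut-injective; <-cmp; <-asym; <-irrefl;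
         remQuot-combine; combine-remQuot; combine-injective; cast-involutive)
open import Data.List using (List; []; _∷_; _++_; foldr; map; filter; length; lookup; tabulate; allFin)
open import Data.List.Properties using (length-++; length-map)
open import Data.List.Membership.Propositional using (_∈_)
open import Data.List.Membership.Propositional.Properties
  using (∈-filter⁺; ∈-filter⁻; ∈-map⁺; ∈-map⁻; ∈-++⁺ˡ; ∈-++⁺ʳ; ∈-++⁻; ∈-allFin; ∈-lookup)
open import Data.List.Relation.Unary.All as All using ([])
open import Data.List.Relation.Unary.Any as Any using (here)
open import Data.List.Relation.Unary.Any.Properties using (lookup-index)
open import Data.List.Relation.Unary.AllPairs using (_∷_; [])
open import Data.List.Relation.Unary.Unique.Propositional using (Unique)
import Data.List.Relation.Unary.Unique.Propositional.Properties as Unique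
open import Data.Nat using (ℕ; zero; suc; _+_; _*_; _≥_)
open import Data.Nat.Properties
  using (1+n≰n; +-identityʳ; *-cancelˡ-≡; *-assoc; *-comm; even≢odd)
open import Data.Product using (_×_; _,_; proj₁; proj₂; map₂; uncurry; ∃)
open import Data.Sum using (inj₁; inj₂)
open import Function using (_∘_)
open import Level using (0ℓ)
open import Function.Definitions using (Injective; Surjective)
open import Relation.Binary.Definitions using (tri<; tri≈; tri>)
open import Relation.Binary.PropositionalEquality
  using (_≡_; _≢_; refl; sym; trans; cong; cong₂; subst; module ≡-Reasoning)
open import Relation.Nullary using (¬_; yes; no; contradiction)

open ≡-Reasoning

injective⇒surjective : ∀ {m} {f : Fin m → Fin m} → Injective _≡_ _≡_ f → Surjective _≡_ _≡_ f
injective⇒surjective {suc m} {f} f-injective y with any? (λ x → f x ≟ y)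
... | yes (x , fx≡y) = x , λ { refl → fx≡y }
... | no ∄x = contradiction (injective⇒≤ punchOut-f-injective) 1+n≰n
  where
  y≢f : ∀ x → y ≢ f x
  y≢f x y≡fx = ∄x (x , sym y≡fx)

  punchOut-f-injective : Injective _≡_ _≡_ (λ x → punchOut (y≢f x))
  punchOut-f-injective {a} {b} = f-injective ∘ punchOut-injective (y≢f a) (y≢f b)

strictlySurjective⇒injective : ∀ {m} {f : Fin m → Fin m} →
                               (∀ y → ∃ λ x → f x ≡ y) → Injective _≡_ _≡_ f
strictlySurjective⇒injective {m} {f} surj {a} {b} fa≡fb = begin
  a               ≡⟨ section∘f a ⟨
  section (f a)   ≡⟨ cong section fa≡fb ⟩
  section (f b)   ≡⟨ section∘f b ⟩
  b               ∎
  where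
  section : Fin m → Fin m
  section = proj₁ ∘ surj

  f∘section : ∀ y → f (section y) ≡ y
  f∘section = proj₂ ∘ surj

  section-injective : Injective _≡_ _≡_ section
  section-injective {y} {y′} eq = trans (sym (f∘section y)) (trans (cong f eq) (f∘section y′))

  section∘f : ∀ x → section (f x) ≡ x
  section∘f x with injective⇒surjective section-injective x
  ... | x′ , section⁻¹ = section⁻¹ (trans (cong f (sym (section⁻¹ refl))) (f∘section x′))

remQuot-injective : ∀ {a} k {i j : Fin (a * k)} → remQuot {a} k i ≡ remQuot k j → i ≡ j
remQuot-injective {a} k {i} {j} eq = begin
  i                                 ≡⟨ combine-remQuot {a} k i ⟨
  uncurry combine (remQuot {a} k i) ≡⟨ cong (uncurry combine) eq ⟩
  uncurry combine (remQuot {a} k j) ≡⟨ combine-remQuot {a} k j ⟩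
  j                                 ∎

lookup-injective : ∀ {A : Set} {xs : List A} → Unique xs → Injective _≡_ _≡_ (lookup xs)
lookup-injective (_ ∷ _)         {zero}  {zero}  _  = refl
lookup-injective (x∉xs ∷ _)      {zero}  {suc j} eq = contradiction eq (All.lookup x∉xs (∈-lookup j))
lookup-injective (x∉xs ∷ _)      {suc i} {zero}  eq = contradiction (sym eq) (All.lookup x∉xs (∈-lookup i))
lookup-injective (_ ∷ xs-unique) {suc i} {suc j} eq = cong suc (lookup-injective xs-unique eq)

length-unique-complete : ∀ {m} {xs : List (Fin m)} → Unique xs → (∀ a → a ∈ xs) → length xs ≡ m
length-unique-complete {xs = xs} xs-unique complete =
  cantor-schröder-bernstein (lookup-injective xs-unique) index-injective
  where
  index-injective : Injective _≡_ _≡_ (λ a → Any.index (complete a))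
  index-injective {a} {b} eq = begin
    a                                  ≡⟨ lookup-index (complete a) ⟩
    lookup xs (Any.index (complete a)) ≡⟨ cong (lookup xs) eq ⟩
    lookup xs (Any.index (complete b)) ≡⟨ lookup-index (complete b) ⟨
    b                                  ∎

module Involution {m : ℕ} (τ : Fin m → Fin m) (τ-involutive : ∀ a → τ (τ a) ≡ a) where

  τ-injective : Injective _≡_ _≡_ τ
  τ-injective {a} {b} eq = trans (sym (τ-involutive a)) (trans (cong τ eq) (τ-involutive b))

  cycleMinima : List (Fin m)
  cycleMinima = filter (λ a → a <? τ a) (allFin m)

  ∈-cycleMinima⁺ : ∀ {a} → a < τ a → a ∈ cycleMinima
  ∈-cycleMinima⁺ = ∈-filter⁺ (λ a → a <? τ a) (∈-allFin _)

  ∈-cycleMinima⁻ : ∀ {a} → a ∈ cycleMinima → a < τ a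
  ∈-cycleMinima⁻ = proj₂ ∘ ∈-filter⁻ (λ a → a <? τ a) {xs = allFin m}

  ∈-τ-cycleMinima⁻ : ∀ {a} → a ∈ map τ cycleMinima → τ a < a
  ∈-τ-cycleMinima⁻ a∈ with ∈-map⁻ τ a∈
  ... | b , b∈ , refl = subst (_< τ b) (sym (τ-involutive b)) (∈-cycleMinima⁻ b∈)

  cycleMinima-unique : Unique cycleMinima
  cycleMinima-unique = Unique.filter⁺ (λ a → a <? τ a) (Unique.allFin⁺ m)

  module _ (fixedPoints : List (Fin m)) where

    orbits : List (Fin m)
    orbits = fixedPoints ++ cycleMinima ++ map τ cycleMinima

    orbits-unique : Unique fixedPoints → (∀ {a} → a ∈ fixedPoints → τ a ≡ a) → Unique orbits
    orbits-unique fixedPoints-unique fixed =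
      Unique.++⁺ fixedPoints-unique
        (Unique.++⁺ cycleMinima-unique (Unique.map⁺ τ-injective cycleMinima-unique) minima-disjoint)
        fixedPoints-disjoint
      where
      minima-disjoint : ∀ {a} → ¬ (a ∈ cycleMinima × a ∈ map τ cycleMinima)
      minima-disjoint (a∈ , a∈′) = <-asym (∈-cycleMinima⁻ a∈) (∈-τ-cycleMinima⁻ a∈′)

      fixedPoints-disjoint : ∀ {a} → ¬ (a ∈ fixedPoints × a ∈ cycleMinima ++ map τ cycleMinima)
      fixedPoints-disjoint (a∈ , a∈′) with ∈-++⁻ cycleMinima a∈′
      ... | inj₁ a∈ₗ = <-irrefl (sym (fixed a∈)) (∈-cycleMinima⁻ a∈ₗ)
      ... | inj₂ a∈ᵣ = <-irrefl (fixed a∈) (∈-τ-cycleMinima⁻ a∈ᵣ)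

    orbits-complete : (∀ a → τ a ≡ a → a ∈ fixedPoints) → ∀ a → a ∈ orbits
    orbits-complete fixed a with <-cmp a (τ a)
    ... | tri< a<τa _ _ = ∈-++⁺ʳ fixedPoints (∈-++⁺ˡ (∈-cycleMinima⁺ a<τa))
    ... | tri≈ _ a≡τa _ = ∈-++⁺ˡ (fixed a (sym a≡τa))
    ... | tri> _ _ τa<a = ∈-++⁺ʳ fixedPoints (∈-++⁺ʳ cycleMinima
          (subst (_∈ map τ cycleMinima) (τ-involutive a)
            (∈-map⁺ τ (∈-cycleMinima⁺ (subst (τ a <_) (sym (τ-involutive a)) τa<a)))))

    length-orbits : length orbits ≡ length fixedPoints + 2 * length cycleMinima
    length-orbits = begin
      length orbits
        ≡⟨ length-++ fixedPoints ⟩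
      length fixedPoints + length (cycleMinima ++ map τ cycleMinima)
        ≡⟨ cong (length fixedPoints +_) (length-++ cycleMinima) ⟩
      length fixedPoints + (length cycleMinima + length (map τ cycleMinima))
        ≡⟨ cong (λ r → length fixedPoints + (length cycleMinima + r))
                (trans (length-map τ cycleMinima) (sym (+-identityʳ _))) ⟩
      length fixedPoints + 2 * length cycleMinima ∎

  length-fixedPoints : (fixedPoints : List (Fin m)) → Unique fixedPoints →
                       (∀ {a} → a ∈ fixedPoints → τ a ≡ a) → (∀ a → τ a ≡ a → a ∈ fixedPoints) →
                       length fixedPoints + 2 * length cycleMinima ≡ m
  length-fixedPoints fixedPoints unique fixed⇒∈ ∈⇒fixed = trans (sym (length-orbits fixedPoints))
    (length-unique-complete (orbits-unique fixedPoints unique fixed⇒∈) (orbits-complete fixedPoints ∈⇒fixed))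

  module FixedPointFree (τ-fixedPointFree : ∀ a → τ a ≢ a) {k : ℕ} (m≡2k : m ≡ 2 * k) where

    length-cycleMinima : length cycleMinima ≡ k
    length-cycleMinima = *-cancelˡ-≡ _ _ 2
      (trans (length-fixedPoints [] [] (λ ()) (λ a τa≡a → contradiction τa≡a (τ-fixedPointFree a))) m≡2k)

    minimum : Fin k → Fin m
    minimum j = lookup cycleMinima (cast (sym length-cycleMinima) j)

    minimum-injective : Injective _≡_ _≡_ minimum
    minimum-injective {i} {j} eq = begin
      i                                  ≡⟨ cast-involutive length-cycleMinima _ i ⟨
      cast length-cycleMinima (cast _ i) ≡⟨ cong (cast length-cycleMinima) (lookup-injective cycleMinima-unique eq) ⟩
      cast length-cycleMinima (cast _ j) ≡⟨ cast-involutive length-cycleMinima _ j ⟩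
      j                                  ∎

    minimum≢τ-minimum : ∀ i j → minimum i ≢ τ (minimum j)
    minimum≢τ-minimum i j eq = <-asym (∈-cycleMinima⁻ (∈-lookup _))
      (∈-τ-cycleMinima⁻ (subst (_∈ map τ cycleMinima) (sym eq) (∈-map⁺ τ (∈-lookup _))))

    pair : Fin 2 × Fin k → Fin m
    pair (0F , j) = minimum j
    pair (1F , j) = τ (minimum j)

    pair-injective : Injective _≡_ _≡_ pair
    pair-injective {0F , i} {0F , j} eq = cong (0F ,_) (minimum-injective eq)
    pair-injective {0F , i} {1F , j} eq = contradiction eq (minimum≢τ-minimum i j)
    pair-injective {1F , i} {0F , j} eq = contradiction (sym eq) (minimum≢τ-minimum j i)
    pair-injective {1F , i} {1F , j} eq = cong (1F ,_) (minimum-injective (τ-injective eq))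

module EvenOrderAbelianGroup {M : ℕ} {op : Op₂ (Fin M)} {e : Fin M} {inv : Op₁ (Fin M)}
  (isAbelianGroup : IsAbelianGroup _≡_ op e inv) {h : ℕ} (M≡2h : M ≡ 2 * h) where

  Γ : AbelianGroup 0ℓ 0ℓ
  Γ = record { isAbelianGroup = isAbelianGroup }

  open AbelianGroup Γ using (_∙_; ε; _⁻¹; _-_; group; assoc; identityˡ; inverseʳ)
  open GroupProperties group using (ε⁻¹≈ε; ⁻¹-involutive)
  open AbelianGroupProperties Γ using (⁻¹-anti-homo‿-; xyx⁻¹≈y)

  nonSquare : ∃ λ c → ∀ a → a ∙ a ≢ c
  nonSquare with all? (λ c → any? (λ a → a ∙ a ≟ c))
  ... | no notAllSquares = map₂ (λ ∄root a a²≡c → ∄root (a , a²≡c))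
                                (¬∀⟶∃¬ M _ (λ c → any? (λ a → a ∙ a ≟ c)) notAllSquares)
  ... | yes allSquares = contradiction (trans (sym M≡2h) (sym count)) (even≢odd h (length cycleMinima))
    where
    square-injective : Injective _≡_ _≡_ (λ a → a ∙ a)
    square-injective = strictlySurjective⇒injective allSquares

    selfInverse⇒ε : ∀ a → a ⁻¹ ≡ a → a ≡ ε
    selfInverse⇒ε a a⁻¹≡a =
      square-injective (trans (cong (a ∙_) (sym a⁻¹≡a)) (trans (inverseʳ a) (sym (identityˡ ε))))

    open Involution _⁻¹ ⁻¹-involutive using (cycleMinima; length-fixedPoints)

    count : suc (2 * length cycleMinima) ≡ M
    count = length-fixedPoints (ε ∷ []) ([] ∷ []) (λ { (here refl) → ε⁻¹≈ε })
                               (λ a a⁻¹≡a → here (selfInverse⇒ε a a⁻¹≡a))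

  c : Fin M
  c = proj₁ nonSquare

  reflect : Fin M → Fin M
  reflect a = c - a

  reflect-involutive : ∀ a → reflect (reflect a) ≡ a
  reflect-involutive a = begin
    c ∙ (c - a) ⁻¹    ≡⟨ cong (c ∙_) (⁻¹-anti-homo‿- c a) ⟩
    c ∙ (a - c)       ≡⟨ assoc c a (c ⁻¹) ⟨
    c ∙ a ∙ c ⁻¹      ≡⟨ xyx⁻¹≈y c a ⟩
    a                 ∎

  ∙-reflect : ∀ a → a ∙ reflect a ≡ c
  ∙-reflect a = trans (sym (assoc a c (a ⁻¹))) (xyx⁻¹≈y a c)

  reflect-fixedPointFree : ∀ a → reflect a ≢ a
  reflect-fixedPointFree a reflect-a≡a =
    proj₂ nonSquare a (trans (cong (a ∙_) (sym reflect-a≡a)) (∙-reflect a))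

  open Involution reflect reflect-involutive using (module FixedPointFree)
  open FixedPointFree reflect-fixedPointFree {h} M≡2h public using (pair; pair-injective)

  pair-sum : ∀ j → pair (0F , j) ∙ pair (1F , j) ≡ c
  pair-sum j = ∙-reflect (pair (0F , j))

module NeighbourhoodSums {A : Set} {op : Op₂ A} {e : A} (isCommutativeMonoid : IsCommutativeMonoid _≡_ op e) where

  private
    monoid : CommutativeMonoid 0ℓ 0ℓ
    monoid = record { isCommutativeMonoid = isCommutativeMonoid }

  open CommutativeMonoid monoid public using (_∙_; ε; identityʳ)
  open CommutativeMonoid monoid using (rawMonoid; assoc; identityˡ)
  open CommutativeMonoidSum monoid public
    using (sum; sum-syntax; sum-cong-≗; ∑-distrib-+; sum-replicate; sum-replicate-zero)
  open RawMonoidDefinitions rawMonoid public using () renaming (_×_ to _·_)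

  ∑-++ : ∀ a b (f : Fin (a + b) → A) →
         ∑[ i < a + b ] f i ≡ ∑[ i < a ] f (i ↑ˡ b) ∙ ∑[ j < b ] f (a ↑ʳ j)
  ∑-++ zero    b f = sym (identityˡ _)
  ∑-++ (suc a) b f = trans (cong (f zero ∙_) (∑-++ a b (f ∘ suc))) (sym (assoc _ _ _))

  ∑-combine : ∀ a b (f : Fin (a * b) → A) → ∑[ i < a * b ] f i ≡ ∑[ x < a ] ∑[ v < b ] f (combine x v)
  ∑-combine zero    b f = refl
  ∑-combine (suc a) b f =
    trans (∑-++ b (a * b) f) (cong (∑[ v < b ] f (v ↑ˡ a * b) ∙_) (∑-combine a b (λ j → f (b ↑ʳ j))))

  ∑-if : ∀ {k} b (f : Fin k → A) → ∑[ v < k ] (if b then f v else ε) ≡ (if b then sum f else ε)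
  ∑-if     true  f = refl
  ∑-if {k} false f = sum-replicate-zero k

  foldr-if≡∑ : ∀ {B : Set} {k} (b : B → Bool) (f : B → A) (t : Fin k → B) →
               foldr (λ y acc → if b y then f y ∙ acc else acc) ε (tabulate t) ≡
               ∑[ i < k ] (if b (t i) then f (t i) else ε)
  foldr-if≡∑ {k = zero}  b f t = refl
  foldr-if≡∑ {k = suc k} b f t with b (t zero)
  ... | true  = cong (f (t zero) ∙_) (foldr-if≡∑ b f (t ∘ suc))
  ... | false = trans (foldr-if≡∑ b f (t ∘ suc)) (sym (identityˡ _))

  foldr-if-const : ∀ {B : Set} (b : B → Bool) (s : A) (xs : List B) →
                   foldr (λ y acc → if b y then s ∙ acc else acc) ε xs ≡
                   foldr (λ y acc → if b y then suc acc else acc) 0 xs · s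
  foldr-if-const b s []       = refl
  foldr-if-const b s (y ∷ xs) with b y
  ... | true  = cong (s ∙_) (foldr-if-const b s xs)
  ... | false = foldr-if-const b s xs

  nbhdSum≡∑ : ∀ (G : Graph) ℓ x → nbhdSum G _∙_ ε ℓ x ≡ ∑[ y < order G ] (if Adj G x y then ℓ y else ε)
  nbhdSum≡∑ G ℓ x = foldr-if≡∑ (Adj G x) ℓ (λ y → y)

  nbhdSum-const : ∀ (G : Graph) s x → nbhdSum G _∙_ ε (λ _ → s) x ≡ degree G x · s
  nbhdSum-const G s x = foldr-if-const (Adj G x) s (allFin (order G))

  lexAdjPair-edgeless : ∀ (G : Graph) k u v x w → lexAdjPair G (edgeless k) (u , v) (x , w) ≡ Adj G u x
  lexAdjPair-edgeless G k u v x w with Adj G u x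
  ... | true  = refl
  ... | false = ∧-zeroʳ _

  nbhdSum-lex-edgeless : ∀ (G : Graph) k (ℓ : Fin (order G * k) → A) {s} →
                         (∀ x → ∑[ v < k ] ℓ (combine x v) ≡ s) →
                         ∀ i → nbhdSum (G ∘ₗ edgeless k) _∙_ ε ℓ i ≡ degree G (proj₁ (remQuot k i)) · s
  nbhdSum-lex-edgeless G k ℓ {s} column-sum i = begin
    nbhdSum (G ∘ₗ edgeless k) _∙_ ε ℓ i
      ≡⟨ nbhdSum≡∑ (G ∘ₗ edgeless k) ℓ i ⟩
    ∑[ j < order G * k ] (if Adj (G ∘ₗ edgeless k) i j then ℓ j else ε)
      ≡⟨ ∑-combine (order G) k _ ⟩
    ∑[ x < order G ] ∑[ w < k ] (if Adj (G ∘ₗ edgeless k) i (combine x w) then ℓ (combine x w) else ε)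
      ≡⟨ sum-cong-≗ (λ x → sum-cong-≗ (λ w →
           cong (λ b → if b then ℓ (combine x w) else ε) (adj-column x w))) ⟩
    ∑[ x < order G ] ∑[ w < k ] (if Adj G u x then ℓ (combine x w) else ε)
      ≡⟨ sum-cong-≗ (λ x → trans (∑-if (Adj G u x) (ℓ ∘ combine x))
                                 (cong (λ t → if Adj G u x then t else ε) (column-sum x))) ⟩
    ∑[ x < order G ] (if Adj G u x then s else ε)
      ≡⟨ nbhdSum≡∑ G (λ _ → s) u ⟨
    nbhdSum G _∙_ ε (λ _ → s) u
      ≡⟨ nbhdSum-const G s u ⟩
    degree G u · s ∎
    where
    u : Fin (order G)
    u = proj₁ (remQuot {order G} k i)

    adj-column : ∀ x w → Adj (G ∘ₗ edgeless k) i (combine x w) ≡ Adj G u x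
    adj-column x w = trans (cong (lexAdjPair G (edgeless k) (remQuot {order G} k i)) (remQuot-combine x w))
                           (lexAdjPair-edgeless G k u (proj₂ (remQuot {order G} k i)) x w)

module ColumnLabelling {g n : ℕ} {op : Op₂ (Fin (g * (2 * n)))} {e : Fin (g * (2 * n))}
  {inv : Op₁ (Fin (g * (2 * n)))} (isAbelianGroup : IsAbelianGroup _≡_ op e inv) where

  order≡2gn : g * (2 * n) ≡ 2 * (g * n)
  order≡2gn = begin
    g * (2 * n)   ≡⟨ *-comm g (2 * n) ⟩
    2 * n * g     ≡⟨ *-assoc 2 n g ⟩
    2 * (n * g)   ≡⟨ cong (2 *_) (*-comm n g) ⟩
    2 * (g * n)   ∎

  open EvenOrderAbelianGroup isAbelianGroup {g * n} order≡2gn public using (c; pair; pair-injective; pair-sum)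
  open NeighbourhoodSums (IsAbelianGroup.isCommutativeMonoid isAbelianGroup)

  -- The n pairs with indices combine x w, w < n, go to column x.
  regroup : Fin g × Fin (2 * n) → Fin 2 × Fin (g * n)
  regroup (x , v) = map₂ (combine x) (remQuot n v)

  regroup-injective : Injective _≡_ _≡_ regroup
  regroup-injective {x , v} {x′ , v′} eq with combine-injective x _ x′ _ (cong proj₂ eq)
  ... | refl , w≡w′ = cong (x ,_) (remQuot-injective n (cong₂ _,_ (cong proj₁ eq) w≡w′))

  label : Fin (g * (2 * n)) → Fin (g * (2 * n))
  label = pair ∘ regroup ∘ remQuot (2 * n)

  label-injective : Injective _≡_ _≡_ label
  label-injective = remQuot-injective (2 * n) ∘ regroup-injective ∘ pair-injective

  column-sum : ∀ x → ∑[ v < 2 * n ] label (combine x v) ≡ n · c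
  column-sum x = begin
    ∑[ v < 2 * n ] label (combine x v)
      ≡⟨ sum-cong-≗ (λ v → cong (pair ∘ regroup) (remQuot-combine x v)) ⟩
    ∑[ v < 2 * n ] pair (regroup (x , v))
      ≡⟨ ∑-combine 2 n _ ⟩
    ∑[ b < 2 ] ∑[ w < n ] pair (regroup (x , combine b w))
      ≡⟨ sum-cong-≗ (λ b → sum-cong-≗ (λ w → cong (pair ∘ map₂ (combine x)) (remQuot-combine b w))) ⟩
    ∑[ w < n ] pair (0F , combine x w) ∙ (∑[ w < n ] pair (1F , combine x w) ∙ ε)
      ≡⟨ cong (∑[ w < n ] pair (0F , combine x w) ∙_) (identityʳ _) ⟩
    ∑[ w < n ] pair (0F , combine x w) ∙ ∑[ w < n ] pair (1F , combine x w)
      ≡⟨ ∑-distrib-+ (λ w → pair (0F , combine x w)) (λ w → pair (1F , combine x w)) ⟨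
    ∑[ w < n ] (pair (0F , combine x w) ∙ pair (1F , combine x w))
      ≡⟨ sum-cong-≗ (λ w → pair-sum (combine x w)) ⟩
    ∑[ w < n ] c
      ≡⟨ sum-replicate n ⟩
    n · c ∎

mainTheorem8 : (G : Graph) → Regular G → (n : ℕ) → n ≥ 1 →
    GroupDistanceMagic (G ∘ₗ edgeless (2 * n))
mainTheorem8 G (k , regular) n _ _∙_ ε _⁻¹ isAbelianGroup =
  label , (label-injective , injective⇒surjective label-injective) , k · (n · c) , magic
  where
  open ColumnLabelling {order G} {n} isAbelianGroup
  open NeighbourhoodSums (IsAbelianGroup.isCommutativeMonoid isAbelianGroup) using (_·_; nbhdSum-lex-edgeless)

  magic : ∀ i → nbhdSum (G ∘ₗ edgeless (2 * n)) _∙_ ε label i ≡ k · (n · c)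
  magic i = trans (nbhdSum-lex-edgeless G (2 * n) label column-sum i) (cong (_· (n · c)) (regular _))
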